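{- Let $\mathfrak{S}$ be a board with no isolated point. Then $2\,\mathscr{F}(\mathfrak{S},\mathbb{Z})\subseteq V(\mathfrak{S},\mathbb{Z})$, i.e. every function $\mathfrak{S}\to 2\mathbb{Z}$ is an integer linear combination of moves.
   Context: A board $\mathfrak{S}$ is a finite subset of $\mathbb{Z}^2$. $\mathscr{F}(\mathfrak{S},\mathbb{Z})$ is the $\mathbb{Z}$-module of integer-valued functions on $\mathfrak{S}$; $[P]$ is the function equal to $1$ at $P$ and $0$ elsewhere. The set of moves $\mathscr{D}(\mathfrak{S})$ consists of all functions $[P]+[Q]-[R]$ with $P,Q,R\in\mathfrak{S}$, $Q=P+v$, $R=P+2v$ for some $v\in\{(\pm1,0),(0,\pm1)\}$; $Q$ is called the middle point of the move and $P,R$ its extremities. $V(\mathfrak{S},\mathbb{Z})$ is the $\mathbb{Z}$-span of $\mathscr{D}(\mathfrak{S})$. Two points $P,R$ are neighbors if they are the two extremities of some move; $\equiv$ denotes the equivalence relation on $\mathfrak{S}$ that is the reflexive and transitive closure of the neighbor relation. The board has no isolated point if for every $P\in\mathfrak{S}$ there is $Q\equiv P$ which is the middle point of some move. -}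

module Defs where

open import Data.Integer using (ℤ; +_; -_; _+_; _-_; _*_; -[1+_])
import Data.Integer as ℤ
open import Data.Product using (Σ; ∃; _×_; _,_; proj₁; proj₂)
open import Data.Product.Properties using (≡-dec)
open import Data.List using (List; map; foldr)
open import Data.List.Membership.Propositional using (_∈_)
open import Relation.Nullary using (yes; no)
open import Relation.Binary.PropositionalEquality using (_≡_)
open import Relation.Binary.Construct.Closure.ReflexiveTransitive using (Star)

Point : Set
Point = ℤ × ℤ

-- A board: a finite subset of ℤ², given by a (finite) list of its points.
Board : Set
Board = List Point

data Dir : Set where
  east west north south : Dir

vec : Dir → Point
vec east  = (+ 1 , + 0)
vec west  = (-[1+ 0 ] , + 0)
vec north = (+ 0 , + 1)
vec south = (+ 0 , -[1+ 0 ])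

_⊕_ : Point → Point → Point
(a , b) ⊕ (c , d) = (a + c , b + d)

shift : Point → ℤ → Dir → Point
shift P k d = P ⊕ (k * proj₁ (vec d) , k * proj₂ (vec d))

record Move (S : Board) : Set where
  constructor mkMove
  field
    start : Point
    dir   : Dir
    start∈ : start ∈ S
    mid∈   : shift start (+ 1) dir ∈ S
    end∈   : shift start (+ 2) dir ∈ S

  middle : Point
  middle = shift start (+ 1) dir

  end : Point
  end = shift start (+ 2) dir

open Move public

indicator : Point → Point → ℤ
indicator P X with ≡-dec ℤ._≟_ ℤ._≟_ P X
... | yes _ = + 1
... | no  _ = + 0

moveFun : {S : Board} → Move S → Point → ℤ
moveFun m X = indicator (start m) X + indicator (middle m) X - indicator (end m) X

Neighbors : Board → Point → Point → Set
Neighbors S P R = Σ (Move S) λ m →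
  ((start m ≡ P) × (end m ≡ R)) Data.Sum.⊎ ((start m ≡ R) × (end m ≡ P))
  where import Data.Sum

Equiv : Board → Point → Point → Set
Equiv S = Star (Neighbors S)

NoIsolatedPoint : Board → Set
NoIsolatedPoint S = ∀ P → P ∈ S →
  Σ Point λ Q → Equiv S P Q × Σ (Move S) λ m → middle m ≡ Q

InV : (S : Board) → (Point → ℤ) → Set
InV S g = Σ (List (ℤ × Move S)) λ cs →
  ∀ X → X ∈ S → g X ≡ foldr _+_ (+ 0) (map (λ cm → proj₁ cm * moveFun (proj₂ cm) X) cs)

module Submission where

-- Reversing a move m = [P] + [Q] - [R] gives the move [R] + [Q] - [P],
-- so  m + rev m = 2[Q]  and  m - rev m = 2[P] - 2[R].  Hence 2[P] - 2[R] lies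
-- in the span V whenever P and R are neighbours, and by chaining whenever
-- P ≡ R.  If P ≡ Q with Q a middle point, then 2[P] = (2[P] - 2[Q]) + 2[Q]
-- lies in V; with no isolated points this holds for every P in the board.
-- Finally 2f agrees on the board with  2 Σ_{P ∈ L} f(P)[P]  where L is the
-- board listed without repetitions, which is a combination of the 2[P].

open import Defs
open import Data.Integer using (ℤ; +_; -_; _+_; _-_; _*_)
import Data.Integer as ℤ
import Data.Integer.Properties as ℤP
open import Data.Integer.Tactic.RingSolver using (solve-∀)
open import Data.Product using (Σ; _×_; _,_; proj₁; proj₂)
open import Data.Product.Properties using (≡-dec)
open import Data.Sum using (inj₁; inj₂)
open import Data.List using (List; []; _∷_; map; foldr; _++_; deduplicate)
open import Data.List.Membership.Propositional using (_∈_; _∉_)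
open import Data.List.Membership.Propositional.Properties using (∈-deduplicate⁺; ∈-deduplicate⁻)
open import Data.List.Relation.Unary.Any using (here; there)
import Data.List.Relation.Unary.All as All
open import Data.List.Relation.Unary.Unique.Propositional using (Unique; _∷_)
open import Data.List.Relation.Unary.Unique.DecPropositional.Properties using (deduplicate-!)
open import Relation.Binary.Definitions using (DecidableEquality)
open import Relation.Binary.PropositionalEquality
open import Relation.Binary.Construct.Closure.ReflexiveTransitive using (ε; _◅_)
open import Relation.Nullary using (yes; no; ¬_)
open import Data.Empty using (⊥-elim)

-- Decidable equality of points, the one used by  indicator.
_≟ₚ_ : DecidableEquality Point
_≟ₚ_ = ≡-dec ℤ._≟_ ℤ._≟_

Combination : Board → Set
Combination S = List (ℤ × Move S)

eval : {S : Board} → Combination S → Point → ℤ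
eval cs X = foldr _+_ (+ 0) (map (λ cm → proj₁ cm * moveFun (proj₂ cm) X) cs)

InSpan : Board → (Point → ℤ) → Set
InSpan S g = Σ (Combination S) λ cs → ∀ X → g X ≡ eval cs X

eval-++ : {S : Board} (cs ds : Combination S) (X : Point) →
  eval (cs ++ ds) X ≡ eval cs X + eval ds X
eval-++ []             ds X = sym (ℤP.+-identityˡ (eval ds X))
eval-++ ((a , m) ∷ cs) ds X = begin
  a * moveFun m X + eval (cs ++ ds) X        ≡⟨ cong (_+_ (a * moveFun m X)) (eval-++ cs ds X) ⟩
  a * moveFun m X + (eval cs X + eval ds X)  ≡⟨ sym (ℤP.+-assoc (a * moveFun m X) (eval cs X) (eval ds X)) ⟩
  a * moveFun m X + eval cs X + eval ds X    ∎
  where open ≡-Reasoning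

eval-scale : {S : Board} (k : ℤ) (cs : Combination S) (X : Point) →
  eval (map (λ cm → (k * proj₁ cm , proj₂ cm)) cs) X ≡ k * eval cs X
eval-scale k []             X = sym (ℤP.*-zeroʳ k)
eval-scale k ((a , m) ∷ cs) X = begin
  k * a * moveFun m X + eval (map _ cs) X    ≡⟨ cong₂ _+_ (ℤP.*-assoc k a (moveFun m X)) (eval-scale k cs X) ⟩
  k * (a * moveFun m X) + k * eval cs X      ≡⟨ sym (ℤP.*-distribˡ-+ k (a * moveFun m X) (eval cs X)) ⟩
  k * (a * moveFun m X + eval cs X)          ∎
  where open ≡-Reasoning

span-ext : {S : Board} {g h : Point → ℤ} → (∀ X → g X ≡ h X) → InSpan S g → InSpan S h
span-ext g≡h (cs , g≡cs) = cs , λ X → trans (sym (g≡h X)) (g≡cs X)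

span-zero : {S : Board} → InSpan S (λ _ → + 0)
span-zero = [] , λ _ → refl

span-add : {S : Board} {g h : Point → ℤ} →
  InSpan S g → InSpan S h → InSpan S (λ X → g X + h X)
span-add (cs , g≡cs) (ds , h≡ds) =
  cs ++ ds , λ X → trans (cong₂ _+_ (g≡cs X) (h≡ds X)) (sym (eval-++ cs ds X))

span-scale : {S : Board} {g : Point → ℤ} (k : ℤ) → InSpan S g → InSpan S (λ X → k * g X)
span-scale k (cs , g≡cs) =
  map (λ cm → (k * proj₁ cm , proj₂ cm)) cs ,
  λ X → trans (cong (k *_) (g≡cs X)) (sym (eval-scale k cs X))

span-move : {S : Board} (m : Move S) → InSpan S (moveFun m)
span-move m = (+ 1 , m) ∷ [] , λ X →
  sym (trans (ℤP.+-identityʳ (+ 1 * moveFun m X)) (ℤP.*-identityˡ (moveFun m X)))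

opposite : Dir → Dir
opposite east  = west
opposite west  = east
opposite north = south
opposite south = north

negate-step : ∀ x k u → x + k * u ≡ x + (- k) * (- u)
negate-step = solve-∀

shift-opposite : ∀ P k d → shift P k (opposite d) ≡ shift P (- k) d
shift-opposite (x , y) k east  = cong₂ _,_ (negate-step x k (- + 1)) (negate-step y k (+ 0))
shift-opposite (x , y) k west  = cong₂ _,_ (negate-step x k (+ 1))   (negate-step y k (+ 0))
shift-opposite (x , y) k north = cong₂ _,_ (negate-step x k (+ 0))   (negate-step y k (- + 1))
shift-opposite (x , y) k south = cong₂ _,_ (negate-step x k (+ 0))   (negate-step y k (+ 1))

shift-shift : ∀ P a b d → shift (shift P a d) b d ≡ shift P (a + b) d
shift-shift (x , y) a b d = cong₂ _,_ (add-steps x a b (proj₁ (vec d))) (add-steps y a b (proj₂ (vec d)))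
  where add-steps : ∀ x a b u → (x + a * u) + b * u ≡ x + (a + b) * u
        add-steps = solve-∀

shift-zero : ∀ P d → shift P (+ 0) d ≡ P
shift-zero (x , y) d = cong₂ _,_ (no-step x (proj₁ (vec d))) (no-step y (proj₂ (vec d)))
  where no-step : ∀ x u → x + + 0 * u ≡ x
        no-step = solve-∀

shift-back : ∀ P k l d → shift (shift P k d) l (opposite d) ≡ shift P (k - l) d
shift-back P k l d = trans (shift-opposite (shift P k d) l d) (shift-shift P k (- l) d)

reverse : {S : Board} → Move S → Move S
reverse {S} (mkMove P d P∈ Q∈ R∈) = mkMove (shift P (+ 2) d) (opposite d) R∈
  (subst (_∈ S) (sym (shift-back P (+ 2) (+ 1) d)) Q∈)
  (subst (_∈ S) (sym (trans (shift-back P (+ 2) (+ 2) d) (shift-zero P d))) P∈)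

reverse-moveFun : {S : Board} (m : Move S) (X : Point) →
  moveFun (reverse m) X ≡ indicator (end m) X + indicator (middle m) X - indicator (start m) X
reverse-moveFun (mkMove P d _ _ _) X =
  cong₂ (λ Q P′ → indicator (shift P (+ 2) d) X + indicator Q X - indicator P′ X)
        (shift-back P (+ 2) (+ 1) d)
        (trans (shift-back P (+ 2) (+ 2) d) (shift-zero P d))

span-twice-middle : {S : Board} (m : Move S) → InSpan S (λ X → + 2 * indicator (middle m) X)
span-twice-middle m = span-ext sum-is (span-add (span-move m) (span-move (reverse m)))
  where
  identity : ∀ p q r → (p + q - r) + (r + q - p) ≡ + 2 * q
  identity = solve-∀
  sum-is : ∀ X → moveFun m X + moveFun (reverse m) X ≡ + 2 * indicator (middle m) X
  sum-is X = trans (cong (_+_ (moveFun m X)) (reverse-moveFun m X))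
                   (identity (indicator (start m) X) (indicator (middle m) X) (indicator (end m) X))

twiceDiff : Point → Point → Point → ℤ
twiceDiff P R X = + 2 * indicator P X - + 2 * indicator R X

span-twice-extremities : {S : Board} (m : Move S) → InSpan S (twiceDiff (start m) (end m))
span-twice-extremities m =
  span-ext difference-is (span-add (span-move m) (span-scale (- + 1) (span-move (reverse m))))
  where
  identity : ∀ p q r → (p + q - r) + (- + 1) * (r + q - p) ≡ + 2 * p - + 2 * r
  identity = solve-∀
  difference-is : ∀ X → moveFun m X + (- + 1) * moveFun (reverse m) X ≡ twiceDiff (start m) (end m) X
  difference-is X = trans (cong (λ v → moveFun m X + (- + 1) * v) (reverse-moveFun m X))
                          (identity (indicator (start m) X) (indicator (middle m) X) (indicator (end m) X))

twiceDiff-swap : ∀ P R X → (- + 1) * twiceDiff P R X ≡ twiceDiff R P X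
twiceDiff-swap P R X = negate (indicator P X) (indicator R X)
  where negate : ∀ a b → (- + 1) * (+ 2 * a - + 2 * b) ≡ + 2 * b - + 2 * a
        negate = solve-∀

twiceDiff-chain : ∀ P Q R X → twiceDiff P Q X + twiceDiff Q R X ≡ twiceDiff P R X
twiceDiff-chain P Q R X = telescope (indicator P X) (indicator Q X) (indicator R X)
  where telescope : ∀ a b c → (+ 2 * a - + 2 * b) + (+ 2 * b - + 2 * c) ≡ + 2 * a - + 2 * c
        telescope = solve-∀

span-neighbors : {S : Board} {P R : Point} → Neighbors S P R → InSpan S (twiceDiff P R)
span-neighbors (m , inj₁ (refl , refl)) = span-twice-extremities m
span-neighbors (m , inj₂ (refl , refl)) =
  span-ext (twiceDiff-swap (start m) (end m)) (span-scale (- + 1) (span-twice-extremities m))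

-- 2[P] - 2[R] ∈ V whenever P ≡ R, by telescoping along the chain of neighbours.
span-equiv : {S : Board} {P R : Point} → Equiv S P R → InSpan S (twiceDiff P R)
span-equiv {P = P} ε = span-ext (λ X → sym (ℤP.+-inverseʳ (+ 2 * indicator P X))) span-zero
span-equiv {P = P} {R} (_◅_ {j = Q} P~Q Q≡R) =
  span-ext (twiceDiff-chain P Q R) (span-add (span-neighbors P~Q) (span-equiv Q≡R))

span-twice-point : {S : Board} → NoIsolatedPoint S → ∀ P → P ∈ S →
  InSpan S (λ X → + 2 * indicator P X)
span-twice-point noIsolated P P∈S with noIsolated P P∈S
... | _ , P≡Q , m , refl =
  span-ext add-back (span-add (span-equiv P≡Q) (span-twice-middle m))
  where
  cancel : ∀ a b → (+ 2 * a - + 2 * b) + + 2 * b ≡ + 2 * a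
  cancel = solve-∀
  add-back : ∀ X → twiceDiff P (middle m) X + + 2 * indicator (middle m) X ≡ + 2 * indicator P X
  add-back X = cancel (indicator P X) (indicator (middle m) X)

pointSum : List Point → (Point → ℤ) → Point → ℤ
pointSum []      h X = + 0
pointSum (P ∷ L) h X = h P * indicator P X + pointSum L h X

indicator-self : ∀ P → indicator P P ≡ + 1
indicator-self P with P ≟ₚ P
... | yes _   = refl
... | no  P≢P = ⊥-elim (P≢P refl)

indicator-other : ∀ {P X} → ¬ P ≡ X → indicator P X ≡ + 0
indicator-other {P} {X} P≢X with P ≟ₚ X
... | yes P≡X = ⊥-elim (P≢X P≡X)
... | no  _   = refl

weighted-other : (h : Point → ℤ) {P X : Point} → ¬ P ≡ X → h P * indicator P X ≡ + 0
weighted-other h {P} P≢X = trans (cong (h P *_) (indicator-other P≢X)) (ℤP.*-zeroʳ (h P))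

pointSum-outside : ∀ L (h : Point → ℤ) X → X ∉ L → pointSum L h X ≡ + 0
pointSum-outside []      h X X∉L = refl
pointSum-outside (P ∷ L) h X X∉L =
  cong₂ _+_ (weighted-other h {P} (λ P≡X → X∉L (here (sym P≡X))))
            (pointSum-outside L h X (λ X∈L → X∉L (there X∈L)))

pointSum-unique : ∀ {L} → Unique L → ∀ (h : Point → ℤ) X → X ∈ L → pointSum L h X ≡ h X
pointSum-unique {P ∷ L} (P≢L ∷ _) h X (here refl) = begin
  h X * indicator X X + pointSum L h X  ≡⟨ cong₂ _+_ (cong (h X *_) (indicator-self X)) (pointSum-outside L h X X∉L) ⟩
  h X * + 1 + + 0                       ≡⟨ trans (ℤP.+-identityʳ _) (ℤP.*-identityʳ (h X)) ⟩
  h X                                   ∎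
  where
  open ≡-Reasoning
  X∉L : X ∉ L
  X∉L X∈L = All.lookup P≢L X∈L refl
pointSum-unique {P ∷ L} (P≢L ∷ uniqueL) h X (there X∈L) = begin
  h P * indicator P X + pointSum L h X  ≡⟨ cong₂ _+_ (weighted-other h {P} (All.lookup P≢L X∈L)) (pointSum-unique uniqueL h X X∈L) ⟩
  + 0 + h X                             ≡⟨ ℤP.+-identityˡ (h X) ⟩
  h X                                   ∎
  where open ≡-Reasoning

span-twice-pointSum : {S : Board} → NoIsolatedPoint S → ∀ (h : Point → ℤ) L → (∀ {P} → P ∈ L → P ∈ S) →
  InSpan S (λ X → + 2 * pointSum L h X)
span-twice-pointSum noIsolated h []      L⊆S = span-ext (λ X → sym (ℤP.*-zeroʳ (+ 2))) span-zero
span-twice-pointSum noIsolated h (P ∷ L) L⊆S =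
  span-ext regroup
    (span-add (span-scale (h P) (span-twice-point noIsolated P (L⊆S (here refl))))
              (span-twice-pointSum noIsolated h L (λ Q∈L → L⊆S (there Q∈L))))
  where
  distribute : ∀ a b c → a * (+ 2 * b) + + 2 * c ≡ + 2 * (a * b + c)
  distribute = solve-∀
  regroup : ∀ X → h P * (+ 2 * indicator P X) + + 2 * pointSum L h X ≡ + 2 * pointSum (P ∷ L) h X
  regroup X = distribute (h P) (indicator P X) (pointSum L h X)

theorem1 : (S : Board) → NoIsolatedPoint S →
    (f : Point → ℤ) → InV S (λ X → + 2 * f X)
theorem1 S noIsolated f = cs , agrees
  where
  L : List Point
  L = deduplicate _≟ₚ_ S
  spanned : InSpan S (λ X → + 2 * pointSum L f X)
  spanned = span-twice-pointSum noIsolated f L (∈-deduplicate⁻ _≟ₚ_ S)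
  cs : Combination S
  cs = proj₁ spanned
  agrees : ∀ X → X ∈ S → + 2 * f X ≡ eval cs X
  agrees X X∈S = trans (cong (+ 2 *_) (sym (pointSum-unique (deduplicate-! _≟ₚ_ S) f X (∈-deduplicate⁺ _≟ₚ_ X∈S))))
                       (proj₂ spanned X)
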